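{- Let $\rho$ be a reduced word with run decomposition $(\rho^{(k)}|\cdots|\rho^{(1)})$. Then the descent tableau $\mathbb D(\rho)$ is an increasing Young tableau if and only if $\mathrm{drop}_i(\rho)=\rho$ for all $1\le i<k$.
   Context: Reduced words: a word $(\rho_\ell,\ldots,\rho_1)$ of positive integers ($\rho_\ell$ leftmost) is reduced if $s_{\rho_\ell}\cdots s_{\rho_1}$ is a permutation with exactly $\ell$ inversions ($s_i=(i\ i{+}1)$). Run decomposition and descent tableau: the run decomposition writes $\rho=\rho^{(k)}\cdots\rho^{(1)}$ as a concatenation of maximal consecutive segments strictly increasing from left to right. $\mathbb D(\rho)$ is the left-justified array whose row $j$ (row $1$ at the bottom) is $\rho^{(j)}$. An increasing Young tableau is a left-justified array of rows with row lengths weakly decreasing from bottom to top, rows strictly increasing left to right and columns strictly increasing bottom to top. Drop. Increasing words are written left to right, $\tau=\tau_1\cdots\tau_t$, $\tau_1<\cdots<\tau_t$, and similarly $\sigma=\sigma_1\cdots\sigma_s$. The drop alignment of $\sigma$ below $\tau$: if $\tau_j>\sigma_j$ for all $j\le\min(s,t)$, $\sigma_j$ is placed in column $j$ (below $\tau_j$ when $j\le t$); otherwise, with $j_1$ least such that $\tau_{j_1}\le\sigma_{j_1}$, $\sigma_1..\sigma_{j_1-1}$ go in columns $1..j_1-1$, column $j_1$ gets no letter of $\sigma$, and $\sigma_{j_1}\cdots\sigma_s$ is aligned recursively below $\tau_{j_1+1}\cdots\tau_t$. Let $x_1,\dots,x_k$ be, left to right, the letters of $\tau$ with nothing below; factor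 $\tau=\tau^{(0)}x_1\tau^{(1)}\cdots x_k\tau^{(k)}$ and $\sigma=\sigma^{(0)}\cdots\sigma^{(k)}\sigma^{(k+1)}$ with $\sigma^{(j)}$ directly below $\tau^{(j)}$ ($0\le j\le k$) and $\sigma^{(k+1)}$ the letters right of column $t$. For $\tau\sigma$ reduced, $\mathrm{drop}(\tau\sigma)$ is the pair (top row, bottom row) $=(\tau^{(0)}\tau^{(1)}\cdots\tau^{(k)},\ \sigma^{(0)}x_1\hat\sigma^{(1)}\cdots x_k\hat\sigma^{(k)}\sigma^{(k+1)})$ with $\hat\sigma^{(j)}_i=\sigma^{(j)}_i+1$ for $i\le b_j$ and $=\sigma^{(j)}_i$ otherwise, where $b_j=\max\{b\ge0:\tau^{(j)}_i=\sigma^{(j)}_1+i\ \forall\,1\le i\le b\}$ if $x_j=\tau^{(j)}_1-1$ and $b_j=0$ otherwise. For $\rho$ with (increasing) row decomposition $(\rho^{(k)}|\cdots|\rho^{(1)})$, $\mathrm{drop}_i(\rho)$ is obtained by replacing $\rho^{(i+1)}\rho^{(i)}$ by $\mathrm{drop}(\rho^{(i+1)}\rho^{(i)})$ (with $\tau=\rho^{(i+1)}$, $\sigma=\rho^{(i)}$). -}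

module Defs where

open import Data.Nat using (ℕ; zero; suc; _+_; _∸_; _⊔_; _<_; _<ᵇ_; _≡ᵇ_)
open import Data.Bool using (Bool; true; false; if_then_else_; _∧_)
open import Data.List using (List; []; _∷_; _++_; map; concatMap; foldr; upTo; length; reverse)
open import Data.Nat.ListAction using (sum)
open import Data.List.Relation.Unary.All using (All)
open import Data.List.Relation.Unary.Linked using (Linked)
open import Data.Maybe using (Maybe; just; nothing)
open import Data.Product using (_×_; _,_; proj₁; proj₂)
open import Function using (_∘_)

-- Words are lists of naturals, written left to right: ρ = ρ_ℓ ⋯ ρ_1.

swap : ℕ → ℕ → ℕ
swap a x = if x ≡ᵇ a then suc a else (if x ≡ᵇ suc a then a else x)

perm : List ℕ → ℕ → ℕ
perm ρ x = foldr swap x ρ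

-- w fixes every point > max ρ + 1, so it is a permutation of {1,…,n}
-- with n = max ρ + 1 (and fixes 0)
support : List ℕ → ℕ
support ρ = suc (foldr _⊔_ 0 ρ)

oneTo : ℕ → List ℕ
oneTo n = map suc (upTo n)

inversions : List ℕ → ℕ
inversions ρ =
  sum (map (λ i → sum (map (λ j → if (i <ᵇ j) ∧ (perm ρ j <ᵇ perm ρ i) then 1 else 0)
                             (oneTo (support ρ))))
           (oneTo (support ρ)))

Reduced : List ℕ → Set
Reduced ρ = inversions ρ ≡ length ρ
  where open import Relation.Binary.PropositionalEquality using (_≡_)

-- Run decomposition: maximal strictly increasing consecutive segments,
-- listed left to right, i.e. runs ρ = [ρ^(k), …, ρ^(1)].

private
  runsFrom : ℕ → List ℕ → List ℕ × List (List ℕ)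
  runsFrom a [] = (a ∷ [] , [])
  runsFrom a (b ∷ w) with runsFrom b w
  ... | (r , rs) = if a <ᵇ b then (a ∷ r , rs) else (a ∷ [] , r ∷ rs)

runs : List ℕ → List (List ℕ)
runs [] = []
runs (a ∷ w) with runsFrom a w
... | (r , rs) = r ∷ rs

-- Descent tableau 𝔻(ρ), given by its rows from bottom (row 1 = ρ^(1))
-- to top (row k = ρ^(k)).
descentTableau : List ℕ → List (List ℕ)
descentTableau ρ = reverse (runs ρ)

-- Increasing Young tableaux, given by rows listed bottom to top.

data Under : List ℕ → List ℕ → Set where
  done : ∀ {r} → Under r []
  step : ∀ {a b r u} → a < b → Under r u → Under (a ∷ r) (b ∷ u)

IncreasingYoung : List (List ℕ) → Set
IncreasingYoung rows = All (Linked _<_) rows × Linked Under rows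

-- Drop alignment of σ below τ: for each letter of τ (left to right),
-- the letter of σ placed below it (if any), together with the letters of
-- σ lying to the right of the last column of τ.
align : List ℕ → List ℕ → List (ℕ × Maybe ℕ) × List ℕ
align [] σ = ([] , σ)
align (t ∷ ts) [] = (map (λ x → (x , nothing)) (t ∷ ts) , [])
align (t ∷ ts) (s ∷ ss) with s <ᵇ t
... | true  = let r = align ts ss in ((t , just s) ∷ proj₁ r , proj₂ r)
... | false = let r = align ts (s ∷ ss) in ((t , nothing) ∷ proj₁ r , proj₂ r)

-- Factor the columns as  (τ^(0),σ^(0)) x_1 (τ^(1),σ^(1)) ⋯ x_k (τ^(k),σ^(k)),
-- each block a list of (τ-letter, σ-letter-below) pairs.
segments : List (ℕ × Maybe ℕ) → List (ℕ × ℕ) × List (ℕ × List (ℕ × ℕ))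
segments [] = ([] , [])
segments ((t , just s) ∷ cs) = let r = segments cs in ((t , s) ∷ proj₁ r , proj₂ r)
segments ((t , nothing) ∷ cs) = let r = segments cs in ([] , (t , proj₁ r) ∷ proj₂ r)

-- increment σ^(j)_i for i ≤ b_j, where b_j is the maximal b with
-- τ^(j)_i = σ^(j)_1 + i for all 1 ≤ i ≤ b  (here s1 = σ^(j)_1, i = current index)
bump : ℕ → ℕ → List (ℕ × ℕ) → List ℕ
bump s1 i [] = []
bump s1 i ((t , s) ∷ rest) =
  if t ≡ᵇ (s1 + i) then suc s ∷ bump s1 (suc i) rest else map proj₂ ((t , s) ∷ rest)

hat : ℕ → List (ℕ × ℕ) → List ℕ
hat x [] = []
hat x ((t1 , s1) ∷ rest) =
  if suc x ≡ᵇ t1 then bump s1 1 ((t1 , s1) ∷ rest) else map proj₂ ((t1 , s1) ∷ rest)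

drop : List ℕ → List ℕ → List ℕ × List ℕ
drop τ σ =
  let al   = align τ σ
      sg   = segments (proj₁ al)
      top  = map proj₁ (proj₁ sg) ++ concatMap (map proj₁ ∘ proj₂) (proj₂ sg)
      bot  = map proj₂ (proj₁ sg)
             ++ concatMap (λ xb → proj₁ xb ∷ hat (proj₁ xb) (proj₂ xb)) (proj₂ sg)
             ++ proj₂ al
  in (top , bot)

-- On rows listed bottom to top, replace rows n+1 (= σ) and n+2 (= τ)
-- by the bottom and top rows of drop(τσ).
dropAt : ℕ → List (List ℕ) → List (List ℕ)
dropAt zero (σ ∷ τ ∷ rest) = proj₂ (drop τ σ) ∷ proj₁ (drop τ σ) ∷ rest
dropAt zero rows = rows
dropAt (suc n) [] = []
dropAt (suc n) (r ∷ rs) = r ∷ dropAt n rs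

-- drop_i(ρ), as a row decomposition (ρ^(k) | ⋯ | ρ^(1)) listed left to right:
-- the rows ρ^(i+1) ρ^(i) are replaced by drop(ρ^(i+1) ρ^(i)).
dropᵢ : ℕ → List ℕ → List (List ℕ)
dropᵢ i ρ = reverse (dropAt (i ∸ 1) (reverse (runs ρ)))

-- The rows of 𝔻(ρ) are runs,
-- hence strictly increasing for every word, so only the column condition
-- between consecutive rows carries content.  For two rows σ (below) and
-- τ (above), drop(τσ) = (τ, σ) holds exactly when σ sits under τ in the
-- Young sense: then every letter of σ is aligned in its own column and
-- drop changes nothing, while otherwise some column of τ receives no letter
-- of σ, and that letter leaves the top row, which becomes shorter than τ.
module Submission where

open import Defs
open import Data.Nat using (ℕ; _≤_; _<_)
open import Data.List using (List; length)
open import Data.List.Relation.Unary.All using (All)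
open import Relation.Binary.PropositionalEquality using (_≡_)
open import Function.Bundles using (_⇔_)

open import Data.Bool using (true; false; T)
open import Data.Empty using (⊥-elim)
open import Data.List using ([]; _∷_; _++_; map; concatMap; reverse)
open import Data.List.Properties
  using (length-map; length-reverse; reverse-involutive; reverse-selfInverse; ∷-injectiveˡ; ∷-injectiveʳ)
open import Data.List.Relation.Unary.All using ([]; _∷_)
open import Data.List.Relation.Unary.Linked using (Linked; []; [-]; _∷_)
open import Data.List.Relation.Binary.Permutation.Propositional using (↭-sym)
open import Data.List.Relation.Binary.Permutation.Propositional.Properties
  using (All-resp-↭; ↭-reverse)
open import Data.Maybe using (Maybe; just; nothing)
open import Data.Nat using (zero; suc; z≤n; s≤s; _<ᵇ_; _<?_)
open import Data.Nat.Properties using (<ᵇ⇒<; <⇒<ᵇ; 1+n≰n; m≤n⇒m≤1+n; module ≤-Reasoning)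
open import Data.Product using (_×_; _,_; proj₁; proj₂; ∃₂)
open import Data.Unit using (tt)
open import Function using (_∘_)
open import Function.Bundles using (mk⇔; Equivalence)
open import Relation.Binary.PropositionalEquality
  using (_≢_; refl; sym; trans; cong; cong₂; subst)
open import Relation.Nullary using (¬_; yes; no; contradiction)

mapHead : ∀ {A : Set} → (A → A) → List A → List A
mapHead f []       = []
mapHead f (x ∷ xs) = f x ∷ xs

runs-∷-∷-< : ∀ {a b} w → a < b → runs (a ∷ b ∷ w) ≡ mapHead (a ∷_) (runs (b ∷ w))
runs-∷-∷-< {a} {b} w a<b with a <ᵇ b | <⇒<ᵇ a<b
... | true | _ = refl

runs-∷-∷-≮ : ∀ {a b} w → ¬ a < b → runs (a ∷ b ∷ w) ≡ (a ∷ []) ∷ runs (b ∷ w)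
runs-∷-∷-≮ {a} {b} w a≮b with a <ᵇ b in a<ᵇb
... | true  = contradiction (<ᵇ⇒< a b (subst T (sym a<ᵇb) tt)) a≮b
... | false = refl

runs-∷ : ∀ a w → ∃₂ λ r rs →
  runs (a ∷ w) ≡ (a ∷ r) ∷ rs × Linked _<_ (a ∷ r) × All (Linked _<_) rs
runs-∷ a []      = [] , [] , refl , [-] , []
runs-∷ a (b ∷ w) with runs-∷ b w | a <? b
... | r , rs , eq , incr , incrs | yes a<b =
  b ∷ r , rs , trans (runs-∷-∷-< w a<b) (cong (mapHead (a ∷_)) eq) , a<b ∷ incr , incrs
... | r , rs , eq , incr , incrs | no a≮b =
  [] , (b ∷ r) ∷ rs , trans (runs-∷-∷-≮ w a≮b) (cong ((a ∷ []) ∷_) eq) , [-] , incr ∷ incrs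

runs-increasing : ∀ ρ → All (Linked _<_) (runs ρ)
runs-increasing []      = []
runs-increasing (a ∷ w) with runs-∷ a w
... | _ , _ , eq , incr , incrs rewrite eq = incr ∷ incrs

topRow : List (ℕ × Maybe ℕ) → List ℕ
topRow cs = map proj₁ (proj₁ (segments cs)) ++ concatMap (map proj₁ ∘ proj₂) (proj₂ (segments cs))

length-topRow : ∀ cs → length (topRow cs) ≤ length cs
length-topRow []                   = z≤n
length-topRow ((_ , just _) ∷ cs)  = s≤s (length-topRow cs)
length-topRow ((_ , nothing) ∷ cs) = m≤n⇒m≤1+n (length-topRow cs)

length-align : ∀ τ σ → length (proj₁ (align τ σ)) ≡ length τ
length-align []       σ        = refl
length-align (t ∷ ts) []       = cong suc (length-map _ ts)
length-align (t ∷ ts) (s ∷ ss) with s <ᵇ t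
... | true  = cong suc (length-align ts ss)
... | false = cong suc (length-align ts (s ∷ ss))

topRow-gap : ∀ x cs {t ts} → length cs ≡ length ts → topRow ((x , nothing) ∷ cs) ≢ t ∷ ts
topRow-gap x cs {ts = ts} cs≡ts top≡ = 1+n≰n (begin
  suc (length ts)  ≡⟨ cong length top≡ ⟨
  length (topRow cs) ≤⟨ length-topRow cs ⟩
  length cs        ≡⟨ cs≡ts ⟩
  length ts        ∎)
  where open ≤-Reasoning

Under⇒drop-fixed : ∀ {σ τ} → Under σ τ → drop τ σ ≡ (τ , σ)
Under⇒drop-fixed done = refl
Under⇒drop-fixed (step {a} {b} {r} {u} a<b under) with a <ᵇ b | <⇒<ᵇ a<b
... | true | _ = cong₂ _,_ (cong (b ∷_) (cong proj₁ fixed)) (cong (a ∷_) (cong proj₂ fixed))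
  where
  fixed : drop u r ≡ (u , r)
  fixed = Under⇒drop-fixed under

drop-fixed⇒Under : ∀ τ σ → drop τ σ ≡ (τ , σ) → Under σ τ
drop-fixed⇒Under []       σ        _     = done
drop-fixed⇒Under (t ∷ ts) []       fixed =
  ⊥-elim (topRow-gap t (map (_, nothing) ts) (length-map _ ts) (cong proj₁ fixed))
drop-fixed⇒Under (t ∷ ts) (s ∷ ss) fixed with s <ᵇ t in s<ᵇt
... | true  = step (<ᵇ⇒< s t (subst T (sym s<ᵇt) tt))
  (drop-fixed⇒Under ts ss (cong₂ _,_ (∷-injectiveʳ (cong proj₁ fixed)) (∷-injectiveʳ (cong proj₂ fixed))))
... | false = ⊥-elim (topRow-gap t (proj₁ (align ts (s ∷ ss))) (length-align ts (s ∷ ss))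
                                 (cong proj₁ fixed))

Under⇔drop-fixed : ∀ σ τ → Under σ τ ⇔ (drop τ σ ≡ (τ , σ))
Under⇔drop-fixed σ τ = mk⇔ Under⇒drop-fixed (drop-fixed⇒Under τ σ)

Linked-Under⇒dropAt-fixed : ∀ {rows} → Linked Under rows →
  ∀ n → suc n < length rows → dropAt n rows ≡ rows
Linked-Under⇒dropAt-fixed [-] _ (s≤s ())
Linked-Under⇒dropAt-fixed {σ ∷ τ ∷ rows} (u ∷ _) zero _ =
  cong₂ (λ σ′ τ′ → σ′ ∷ τ′ ∷ rows) (cong proj₂ fixed) (cong proj₁ fixed)
  where
  fixed : drop τ σ ≡ (τ , σ)
  fixed = Equivalence.to (Under⇔drop-fixed σ τ) u
Linked-Under⇒dropAt-fixed {σ ∷ _ ∷ _} (_ ∷ us) (suc n) (s≤s n<) =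
  cong (σ ∷_) (Linked-Under⇒dropAt-fixed us n n<)

dropAt-fixed⇒Linked-Under : ∀ rows →
  (∀ n → suc n < length rows → dropAt n rows ≡ rows) → Linked Under rows
dropAt-fixed⇒Linked-Under []               _     = []
dropAt-fixed⇒Linked-Under (_ ∷ [])         _     = [-]
dropAt-fixed⇒Linked-Under (σ ∷ τ ∷ rows) fixed =
  Equivalence.from (Under⇔drop-fixed σ τ)
    (cong₂ _,_ (∷-injectiveˡ (∷-injectiveʳ fixed₀)) (∷-injectiveˡ fixed₀))
  ∷ dropAt-fixed⇒Linked-Under (τ ∷ rows) (λ n n< → ∷-injectiveʳ (fixed (suc n) (s≤s n<)))
  where
  fixed₀ : dropAt zero (σ ∷ τ ∷ rows) ≡ σ ∷ τ ∷ rows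
  fixed₀ = fixed zero (s≤s (s≤s z≤n))

proposition4p7 : (ρ : List ℕ) → All (1 ≤_) ρ → Reduced ρ →
    IncreasingYoung (descentTableau ρ)
      ⇔ (∀ (i : ℕ) → 1 ≤ i → i < length (runs ρ) → dropᵢ i ρ ≡ runs ρ)
proposition4p7 ρ _ _ = mk⇔
  (λ { (_ , young) (suc n) _ i<k →
         trans (cong reverse (Linked-Under⇒dropAt-fixed young n (in-rows i<k)))
               (reverse-involutive (runs ρ)) })
  (λ fixed →
     All-resp-↭ (↭-sym (↭-reverse (runs ρ))) (runs-increasing ρ)
   , dropAt-fixed⇒Linked-Under rows
       (λ n n< → sym (reverse-selfInverse {x = dropAt n rows} (fixed (suc n) (s≤s z≤n) (in-runs n<)))))
  where
  rows : List (List ℕ)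
  rows = reverse (runs ρ)
  in-rows : ∀ {i} → i < length (runs ρ) → i < length rows
  in-rows = subst (_ <_) (sym (length-reverse (runs ρ)))
  in-runs : ∀ {i} → i < length rows → i < length (runs ρ)
  in-runs = subst (_ <_) (length-reverse (runs ρ))
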